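{- Let $\mathcal T=(\Sigma,\iota,\tau)$ be a first-order transition system, let $r_1,\dots,r_n$ be formulas over $\Sigma$ with free variables among $\vec x$, and let $p,q$ be closed formulas over $\Sigma$. Suppose there exist a closed implicit ranking $(\varphi_\le,\varphi_<)$, closed formulas $\rho,\phi$ over $\Sigma$, and formulas $\psi_1(\vec x),\dots,\psi_n(\vec x)$ over $\Sigma$ such that the following formulas are valid (true in every structure under every assignment): 1. $\iota\to\rho$; 2. $\rho\wedge\tau\to\rho'$; 3. $\rho\wedge p\wedge\neg q\to\phi$; 4. $\phi\wedge\tau\wedge\neg q'\to\phi'$; 5. $\phi\wedge\tau\wedge\neg q'\to\tilde\varphi_\le$; 6. $\phi\to\bigvee_{i=1}^n\exists\vec x.\psi_i(\vec x)$; 7. for all $i$: $\phi\wedge\tau\wedge\neg q'\wedge\psi_i(\vec x)\wedge\neg r_i(\vec x)\to\psi_i'(\vec x)$; 8. for all $i$: $\phi\wedge\tau\wedge\neg q'\wedge\psi_i(\vec x)\wedge r_i(\vec x)\to\tilde\varphi_<$. Then $\mathcal T$ satisfies $\big(\bigwedge_{i}\forall\vec x\,\square\lozenge r_i(\vec x)\big)\to\square(p\to\lozenge q)$: for every trace $\pi$ of $\mathcal T$ such that for every $i$ and every assignment of $\vec x$ into the domain of $\pi$, $r_i(\vec x)$ holds at infinitely many positions of $\pi$, and for every $k$ with $\pi(k)\models p$, there exists $\ell\ge k$ with $\pi(\ell)\models q$.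
   Context: Work in uninterpreted first-order logic with equality. A transition system is $\mathcal T=(\Sigma,\iota,\tau)$ with $\Sigma$ a signature, $\iota$ a closed formula over $\Sigma$ (initial states), and $\tau$ a formula over $\Sigma\uplus\Sigma'$, where $\Sigma'$ is a disjoint copy of $\Sigma$ representing the post-state. For a formula $\gamma$ over $\Sigma$, $\gamma'$ is obtained by replacing each symbol by its copy in $\Sigma'$. A trace of $\mathcal T$ is an infinite sequence $\pi(0),\pi(1),\dots$ of $\Sigma$-structures over a common domain with $\pi(0)\models\iota$ and, for all $i$, $\tau$ holds when $\Sigma$ is interpreted by $\pi(i)$ and $\Sigma'$ by $\pi(i+1)$. Let $\Sigma_0,\Sigma_1$ be disjoint copies of $\Sigma$. A partial order is a wfpo if it has no infinite strictly decreasing sequence. A closed implicit ranking is a pair $(\varphi_\le,\varphi_<)$ of closed formulas over $\Sigma_0\uplus\Sigma_1$ such that for every domain $D$ there exist a set $A$, a wfpo $\le$ on $A$ and a function $f$ from $\Sigma$-structures with domain $D$ to $A$ such that for all such structures $s_0,s_1$: if $\varphi_\le$ holds when $\Sigma_b$ is interpreted by $s_b$ ($b=0,1$) then $f(s_0)\le f(s_1)$, and if $\varphi_<$ holds so interpreted then $f(s_0)<f(s_1)$. The formulas $\tilde\varphi_\le,\tilde\varphi_<$ over $\Sigma\uplus\Sigma'$ are obtained from $\varphi_\le,\varphi_<$ by replacing $\Sigma_0$ by $\Sigma'$ and $\Sigma_1$ by $\Sigma$. -}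

module Defs where

open import Data.Nat using (ℕ; zero; suc; _≤_)
open import Data.Fin using (Fin; zero; suc)
open import Data.Vec using (Vec; []; _∷_)
open import Data.Product using (Σ; _×_; _,_; proj₁; proj₂)
open import Data.Sum using (_⊎_)
open import Data.Empty using (⊥)
open import Data.Unit using (⊤)
open import Relation.Nullary using (¬_)
open import Relation.Binary.PropositionalEquality using (_≡_)
open import Relation.Binary.Structures using (IsPartialOrder)

record Signature : Set₁ where
  field
    Fun      : Set
    Rel      : Set
    funArity : Fun → ℕ
    relArity : Rel → ℕ
open Signature public

-- Two disjoint copies of a signature.  For Σ ⊎ Σ' :  cur = Σ,  nxt = Σ'.
-- For Σ₀ ⊎ Σ₁ :  cur = Σ₀,  nxt = Σ₁.
data Side : Set where
  cur nxt : Side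

swapSide : Side → Side
swapSide cur = nxt
swapSide nxt = cur

Dbl : Signature → Signature
Dbl S = record
  { Fun      = Side × Fun S
  ; Rel      = Side × Rel S
  ; funArity = λ p → funArity S (proj₂ p)
  ; relArity = λ p → relArity S (proj₂ p)
  }

data Term (S : Signature) (n : ℕ) : Set where
  var : Fin n → Term S n
  app : (f : Fun S) → Vec (Term S n) (funArity S f) → Term S n

infixr 6 _∧'_
infixr 5 _∨'_
infixr 4 _⇒'_
infix 3 ∀'_ ∃'_
infix 7 ¬'_

data Formula (S : Signature) (n : ℕ) : Set where
  true' false' : Formula S n
  atom  : (R : Rel S) → Vec (Term S n) (relArity S R) → Formula S n
  _≐_   : Term S n → Term S n → Formula S n
  ¬'_   : Formula S n → Formula S n
  _∧'_ _∨'_ _⇒'_ : Formula S n → Formula S n → Formula S n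
  ∀'_ ∃'_ : Formula S (suc n) → Formula S n

liftRen : ∀ {n k} → (Fin n → Fin k) → Fin (suc n) → Fin (suc k)
liftRen σ zero    = zero
liftRen σ (suc i) = suc (σ i)

mutual
  renT : ∀ {S n k} → (Fin n → Fin k) → Term S n → Term S k
  renT σ (var i)    = var (σ i)
  renT σ (app f ts) = app f (renTs σ ts)

  renTs : ∀ {S n k a} → (Fin n → Fin k) → Vec (Term S n) a → Vec (Term S k) a
  renTs σ []       = []
  renTs σ (t ∷ ts) = renT σ t ∷ renTs σ ts

renF : ∀ {S n k} → (Fin n → Fin k) → Formula S n → Formula S k
renF σ true'      = true'
renF σ false'     = false'
renF σ (atom R ts) = atom R (renTs σ ts)
renF σ (t ≐ u)    = renT σ t ≐ renT σ u
renF σ (¬' φ)     = ¬' renF σ φ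
renF σ (φ ∧' ψ)   = renF σ φ ∧' renF σ ψ
renF σ (φ ∨' ψ)   = renF σ φ ∨' renF σ ψ
renF σ (φ ⇒' ψ)   = renF σ φ ⇒' renF σ ψ
renF σ (∀' φ)     = ∀' (renF (liftRen σ) φ)
renF σ (∃' φ)     = ∃' (renF (liftRen σ) φ)

weaken : ∀ {S m} → Formula S 0 → Formula S m
weaken = renF (λ ())

mutual
  embT : ∀ {S n} → Side → Term S n → Term (Dbl S) n
  embT s (var i)    = var i
  embT s (app f ts) = app (s , f) (embTs s ts)

  embTs : ∀ {S n a} → Side → Vec (Term S n) a → Vec (Term (Dbl S) n) a
  embTs s []       = []
  embTs s (t ∷ ts) = embT s t ∷ embTs s ts

emb : ∀ {S n} → Side → Formula S n → Formula (Dbl S) n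
emb s true'       = true'
emb s false'      = false'
emb s (atom R ts) = atom (s , R) (embTs s ts)
emb s (t ≐ u)     = embT s t ≐ embT s u
emb s (¬' φ)      = ¬' emb s φ
emb s (φ ∧' ψ)    = emb s φ ∧' emb s ψ
emb s (φ ∨' ψ)    = emb s φ ∨' emb s ψ
emb s (φ ⇒' ψ)    = emb s φ ⇒' emb s ψ
emb s (∀' φ)      = ∀' emb s φ
emb s (∃' φ)      = ∃' emb s φ

unp : ∀ {S n} → Formula S n → Formula (Dbl S) n
unp = emb cur

prm : ∀ {S n} → Formula S n → Formula (Dbl S) n
prm = emb nxt

mutual
  swT : ∀ {S n} → Term (Dbl S) n → Term (Dbl S) n
  swT (var i)          = var i
  swT (app (s , f) ts) = app (swapSide s , f) (swTs ts)

  swTs : ∀ {S n a} → Vec (Term (Dbl S) n) a → Vec (Term (Dbl S) n) a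
  swTs []       = []
  swTs (t ∷ ts) = swT t ∷ swTs ts

swF : ∀ {S n} → Formula (Dbl S) n → Formula (Dbl S) n
swF true'             = true'
swF false'            = false'
swF (atom (s , R) ts) = atom (swapSide s , R) (swTs ts)
swF (t ≐ u)           = swT t ≐ swT u
swF (¬' φ)            = ¬' swF φ
swF (φ ∧' ψ)          = swF φ ∧' swF ψ
swF (φ ∨' ψ)          = swF φ ∨' swF ψ
swF (φ ⇒' ψ)          = swF φ ⇒' swF ψ
swF (∀' φ)            = ∀' swF φ
swF (∃' φ)            = ∃' swF φ

-- φ̃ : Σ₀ ↦ Σ'  (cur ↦ nxt),  Σ₁ ↦ Σ  (nxt ↦ cur)
tilde : ∀ {S} → Formula (Dbl S) 0 → Formula (Dbl S) 0
tilde = swF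

closeEx : ∀ {S} (m : ℕ) → Formula S m → Formula S 0
closeEx zero    φ = φ
closeEx (suc m) φ = closeEx m (∃' φ)

bigOr : ∀ {S k} (n : ℕ) → (Fin n → Formula S k) → Formula S k
bigOr zero    f = false'
bigOr (suc n) f = f zero ∨' bigOr n (λ i → f (suc i))

record Structure (S : Signature) (D : Set) : Set₁ where
  field
    funI : (f : Fun S) → Vec D (funArity S f) → D
    relI : (R : Rel S) → Vec D (relArity S R) → Set
open Structure public

pairFun : ∀ {S D} → Structure S D → Structure S D →
          (f : Fun (Dbl S)) → Vec D (funArity (Dbl S) f) → D
pairFun M₀ M₁ (cur , f) = funI M₀ f
pairFun M₀ M₁ (nxt , f) = funI M₁ f

pairRel : ∀ {S D} → Structure S D → Structure S D →
          (R : Rel (Dbl S)) → Vec D (relArity (Dbl S) R) → Set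
pairRel M₀ M₁ (cur , R) = relI M₀ R
pairRel M₀ M₁ (nxt , R) = relI M₁ R

pair : ∀ {S D} → Structure S D → Structure S D → Structure (Dbl S) D
pair M₀ M₁ = record { funI = pairFun M₀ M₁ ; relI = pairRel M₀ M₁ }

ext : ∀ {D : Set} {n} → D → (Fin n → D) → Fin (suc n) → D
ext d ρ zero    = d
ext d ρ (suc i) = ρ i

noEnv : ∀ {D : Set} → Fin 0 → D
noEnv ()

mutual
  evalT : ∀ {S D n} → Structure S D → (Fin n → D) → Term S n → D
  evalT M ρ (var i)    = ρ i
  evalT M ρ (app f ts) = funI M f (evalTs M ρ ts)

  evalTs : ∀ {S D n a} → Structure S D → (Fin n → D) → Vec (Term S n) a → Vec D a
  evalTs M ρ []       = []
  evalTs M ρ (t ∷ ts) = evalT M ρ t ∷ evalTs M ρ ts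

Sat : ∀ {S D n} → Structure S D → Formula S n → (Fin n → D) → Set
Sat M true'       ρ = ⊤
Sat M false'      ρ = ⊥
Sat M (atom R ts) ρ = relI M R (evalTs M ρ ts)
Sat M (t ≐ u)     ρ = evalT M ρ t ≡ evalT M ρ u
Sat M (¬' φ)      ρ = ¬ Sat M φ ρ
Sat M (φ ∧' ψ)    ρ = Sat M φ ρ × Sat M ψ ρ
Sat M (φ ∨' ψ)    ρ = Sat M φ ρ ⊎ Sat M ψ ρ
Sat M (φ ⇒' ψ)    ρ = Sat M φ ρ → Sat M ψ ρ
Sat {D = D} M (∀' φ) ρ = (d : D) → Sat M φ (ext d ρ)
Sat {D = D} M (∃' φ) ρ = Σ D λ d → Sat M φ (ext d ρ)

-- Validity: true in every structure (with nonempty domain) under every assignment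
Valid : ∀ {S n} → Formula S n → Set₁
Valid {S} {n} φ = (D : Set) → D → (M : Structure S D) (ρ : Fin n → D) → Sat M φ ρ

IsWfpo : {A : Set} → (A → A → Set) → Set
IsWfpo {A} _≤_ =
  IsPartialOrder _≡_ _≤_ ×
  ¬ (Σ (ℕ → A) λ a → ∀ i → (a (suc i) ≤ a i) × ¬ (a (suc i) ≡ a i))

ClosedImplicitRanking : (S : Signature) → Formula (Dbl S) 0 → Formula (Dbl S) 0 → Set₁
ClosedImplicitRanking S φ≤ φ< =
  (D : Set) → D →
  Σ Set λ A → Σ (A → A → Set) λ _≤_ → IsWfpo _≤_ ×
  Σ (Structure S D → A) λ f →
    (s₀ s₁ : Structure S D) →
      (Sat (pair s₀ s₁) φ≤ noEnv → f s₀ ≤ f s₁) ×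
      (Sat (pair s₀ s₁) φ< noEnv → (f s₀ ≤ f s₁) × ¬ (f s₀ ≡ f s₁))

record Trace (S : Signature) (ι : Formula S 0) (τ : Formula (Dbl S) 0) : Set₁ where
  field
    Dom       : Set
    inhabited : Dom
    π         : ℕ → Structure S Dom
    initial   : Sat (π 0) ι noEnv
    step      : (i : ℕ) → Sat (pair (π i) (π (suc i))) τ noEnv
open Trace public

Fair : ∀ {S ι τ n m} → Trace S ι τ → (Fin n → Formula S m) → Set
Fair T r = ∀ i (xs : Fin _ → Dom T) (j : ℕ) →
  Σ ℕ λ l → j ≤ l × Sat (π T l) (r i) xs

SatisfiesFairResponse : (S : Signature) (ι : Formula S 0) (τ : Formula (Dbl S) 0)
  (n m : ℕ) → (Fin n → Formula S m) → Formula S 0 → Formula S 0 → Set₁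
SatisfiesFairResponse S ι τ n m r p q =
  (T : Trace S ι τ) → Fair T r →
  (k : ℕ) → Sat (π T k) p noEnv →
  Σ ℕ λ l → k ≤ l × Sat (π T l) q noEnv

-- After position k, as long as q has not been reached, φ is an invariant, the rank never
-- increases, and some obligation ψᵢ(x⃗) is pending.  A pending obligation persists until
-- rᵢ(x⃗) holds, which fairness guarantees, and that step strictly decreases the rank.  So a
-- trace that never reaches q would yield an infinite descent in a well-founded order; excluded
-- middle turns this contradiction into a position where q holds.

module Submission where

open import Defs
open import Data.Nat
  using (ℕ; zero; suc; _+_; _∸_; _≤_; _≤′_; _≤‴_; ≤′-refl; ≤′-step; ≤‴-refl; ≤‴-step)
open import Data.Nat.Properties
  using (≤-refl; <⇒≤; ≤⇒≤′; ≤⇒≤‴; ∸-monoˡ-≤; m+n∸n≡m; m+n≤o⇒n≤o; m∸n+n≡m; m≤n+m)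
open import Data.Fin using (Fin; zero; suc)
open import Data.Vec using (Vec; []; _∷_)
open import Data.Product using (Σ; ∃-syntax; _×_; _,_; proj₁; proj₂; map₂)
open import Data.Sum using (inj₁; inj₂)
open import Data.Empty using (⊥; ⊥-elim)
open import Function using (_∘_)
open import Function.Bundles using (_⇔_; mk⇔; Equivalence)
open import Function.Construct.Identity using (⇔-id)
open import Function.Related.TypeIsomorphisms using (→-cong-⇔; ¬-cong-⇔)
open import Data.Product.Function.NonDependent.Propositional using (_×-⇔_)
open import Data.Sum.Function.Propositional using (_⊎-⇔_)
open import Level using (0ℓ)
open import Axiom.ExcludedMiddle using (ExcludedMiddle)
open import Relation.Nullary using (¬_; Dec; yes; no; contradiction)
open import Relation.Binary.PropositionalEquality using (_≡_; _≗_; refl; sym; cong; cong₂; subst)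
open import Relation.Binary.Structures using (IsPreorder; IsPartialOrder)
import Relation.Binary.Construct.NonStrictToStrict as NonStrictToStrict

open Equivalence using (to; from)

≡⇒⇔ : {A B : Set} → A ≡ B → A ⇔ B
≡⇒⇔ refl = ⇔-id _

∀-cong-⇔ : {A : Set} {P Q : A → Set} →
  (∀ a → P a ⇔ Q a) → ((a : A) → P a) ⇔ ((a : A) → Q a)
∀-cong-⇔ P⇔Q = mk⇔ (λ f a → to (P⇔Q a) (f a)) (λ g a → from (P⇔Q a) (g a))

∃-cong-⇔ : {A : Set} {P Q : A → Set} → (∀ a → P a ⇔ Q a) → Σ A P ⇔ Σ A Q
∃-cong-⇔ P⇔Q = mk⇔ (map₂ (to (P⇔Q _))) (map₂ (from (P⇔Q _)))

select : ∀ {S D} → Side → Structure S D → Structure S D → Structure S D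
select cur M₀ M₁ = M₀
select nxt M₀ M₁ = M₁

module _ {S : Signature} {D : Set} (M₀ M₁ : Structure S D) where

  mutual
    evalT-embT : ∀ {n} s (e : Fin n → D) (t : Term S n) →
      evalT (pair M₀ M₁) e (embT s t) ≡ evalT (select s M₀ M₁) e t
    evalT-embT s   e (var i)    = refl
    evalT-embT cur e (app f ts) = cong (funI M₀ f) (evalTs-embTs cur e ts)
    evalT-embT nxt e (app f ts) = cong (funI M₁ f) (evalTs-embTs nxt e ts)

    evalTs-embTs : ∀ {n a} s (e : Fin n → D) (ts : Vec (Term S n) a) →
      evalTs (pair M₀ M₁) e (embTs s ts) ≡ evalTs (select s M₀ M₁) e ts
    evalTs-embTs s e []       = refl
    evalTs-embTs s e (t ∷ ts) = cong₂ _∷_ (evalT-embT s e t) (evalTs-embTs s e ts)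

  Sat-emb : ∀ {n} s (φ : Formula S n) (e : Fin n → D) →
    Sat (pair M₀ M₁) (emb s φ) e ⇔ Sat (select s M₀ M₁) φ e
  Sat-emb s   true'        e = ⇔-id _
  Sat-emb s   false'       e = ⇔-id _
  Sat-emb cur (atom R ts)  e = ≡⇒⇔ (cong (relI M₀ R) (evalTs-embTs cur e ts))
  Sat-emb nxt (atom R ts)  e = ≡⇒⇔ (cong (relI M₁ R) (evalTs-embTs nxt e ts))
  Sat-emb s   (t ≐ u)      e = ≡⇒⇔ (cong₂ _≡_ (evalT-embT s e t) (evalT-embT s e u))
  Sat-emb s   (¬' φ)       e = ¬-cong-⇔ (Sat-emb s φ e)
  Sat-emb s   (φ ∧' ψ)     e = Sat-emb s φ e ×-⇔ Sat-emb s ψ e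
  Sat-emb s   (φ ∨' ψ)     e = Sat-emb s φ e ⊎-⇔ Sat-emb s ψ e
  Sat-emb s   (φ ⇒' ψ)     e = →-cong-⇔ (Sat-emb s φ e) (Sat-emb s ψ e)
  Sat-emb s   (∀' φ)       e = ∀-cong-⇔ λ d → Sat-emb s φ (ext d e)
  Sat-emb s   (∃' φ)       e = ∃-cong-⇔ λ d → Sat-emb s φ (ext d e)

  Sat-unp : ∀ {n} (φ : Formula S n) (e : Fin n → D) → Sat (pair M₀ M₁) (unp φ) e ⇔ Sat M₀ φ e
  Sat-unp = Sat-emb cur

  Sat-prm : ∀ {n} (φ : Formula S n) (e : Fin n → D) → Sat (pair M₀ M₁) (prm φ) e ⇔ Sat M₁ φ e
  Sat-prm = Sat-emb nxt

  mutual
    evalT-swT : ∀ {n} (e : Fin n → D) (t : Term (Dbl S) n) →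
      evalT (pair M₀ M₁) e (swT t) ≡ evalT (pair M₁ M₀) e t
    evalT-swT e (var i)            = refl
    evalT-swT e (app (cur , f) ts) = cong (funI M₁ f) (evalTs-swTs e ts)
    evalT-swT e (app (nxt , f) ts) = cong (funI M₀ f) (evalTs-swTs e ts)

    evalTs-swTs : ∀ {n a} (e : Fin n → D) (ts : Vec (Term (Dbl S) n) a) →
      evalTs (pair M₀ M₁) e (swTs ts) ≡ evalTs (pair M₁ M₀) e ts
    evalTs-swTs e []       = refl
    evalTs-swTs e (t ∷ ts) = cong₂ _∷_ (evalT-swT e t) (evalTs-swTs e ts)

  Sat-swF : ∀ {n} (φ : Formula (Dbl S) n) (e : Fin n → D) →
    Sat (pair M₀ M₁) (swF φ) e ⇔ Sat (pair M₁ M₀) φ e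
  Sat-swF true'              e = ⇔-id _
  Sat-swF false'             e = ⇔-id _
  Sat-swF (atom (cur , R) ts) e = ≡⇒⇔ (cong (relI M₁ R) (evalTs-swTs e ts))
  Sat-swF (atom (nxt , R) ts) e = ≡⇒⇔ (cong (relI M₀ R) (evalTs-swTs e ts))
  Sat-swF (t ≐ u)            e = ≡⇒⇔ (cong₂ _≡_ (evalT-swT e t) (evalT-swT e u))
  Sat-swF (¬' φ)             e = ¬-cong-⇔ (Sat-swF φ e)
  Sat-swF (φ ∧' ψ)           e = Sat-swF φ e ×-⇔ Sat-swF ψ e
  Sat-swF (φ ∨' ψ)           e = Sat-swF φ e ⊎-⇔ Sat-swF ψ e
  Sat-swF (φ ⇒' ψ)           e = →-cong-⇔ (Sat-swF φ e) (Sat-swF ψ e)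
  Sat-swF (∀' φ)             e = ∀-cong-⇔ λ d → Sat-swF φ (ext d e)
  Sat-swF (∃' φ)             e = ∃-cong-⇔ λ d → Sat-swF φ (ext d e)

module _ {S : Signature} {D : Set} (M : Structure S D) where

  mutual
    evalT-renT : ∀ {n k} {σ : Fin n → Fin k} {e′ : Fin k → D} {e : Fin n → D} →
      e′ ∘ σ ≗ e → (t : Term S n) → evalT M e′ (renT σ t) ≡ evalT M e t
    evalT-renT e′σ≗e (var i)    = e′σ≗e i
    evalT-renT e′σ≗e (app f ts) = cong (funI M f) (evalTs-renTs e′σ≗e ts)

    evalTs-renTs : ∀ {n k a} {σ : Fin n → Fin k} {e′ : Fin k → D} {e : Fin n → D} →
      e′ ∘ σ ≗ e → (ts : Vec (Term S n) a) → evalTs M e′ (renTs σ ts) ≡ evalTs M e ts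
    evalTs-renTs e′σ≗e []       = refl
    evalTs-renTs e′σ≗e (t ∷ ts) = cong₂ _∷_ (evalT-renT e′σ≗e t) (evalTs-renTs e′σ≗e ts)

  ext-liftRen : ∀ {n k} {σ : Fin n → Fin k} {e′ : Fin k → D} {e : Fin n → D} (d : D) →
    e′ ∘ σ ≗ e → ext d e′ ∘ liftRen σ ≗ ext d e
  ext-liftRen d e′σ≗e zero    = refl
  ext-liftRen d e′σ≗e (suc i) = e′σ≗e i

  Sat-renF : ∀ {n k} {σ : Fin n → Fin k} {e′ : Fin k → D} {e : Fin n → D} →
    e′ ∘ σ ≗ e → (φ : Formula S n) → Sat M (renF σ φ) e′ ⇔ Sat M φ e
  Sat-renF eq true'       = ⇔-id _
  Sat-renF eq false'      = ⇔-id _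
  Sat-renF eq (atom R ts) = ≡⇒⇔ (cong (relI M R) (evalTs-renTs eq ts))
  Sat-renF eq (t ≐ u)     = ≡⇒⇔ (cong₂ _≡_ (evalT-renT eq t) (evalT-renT eq u))
  Sat-renF eq (¬' φ)      = ¬-cong-⇔ (Sat-renF eq φ)
  Sat-renF eq (φ ∧' ψ)    = Sat-renF eq φ ×-⇔ Sat-renF eq ψ
  Sat-renF eq (φ ∨' ψ)    = Sat-renF eq φ ⊎-⇔ Sat-renF eq ψ
  Sat-renF eq (φ ⇒' ψ)    = →-cong-⇔ (Sat-renF eq φ) (Sat-renF eq ψ)
  Sat-renF eq (∀' φ)      = ∀-cong-⇔ λ d → Sat-renF (ext-liftRen d eq) φ
  Sat-renF eq (∃' φ)      = ∃-cong-⇔ λ d → Sat-renF (ext-liftRen d eq) φ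

  Sat-weaken : ∀ {m} (φ : Formula S 0) (xs : Fin m → D) → Sat M (weaken φ) xs ⇔ Sat M φ noEnv
  Sat-weaken φ xs = Sat-renF (λ ()) φ

  closeEx-witness : ∀ m (φ : Formula S m) → Sat M (closeEx m φ) noEnv → ∃[ xs ] Sat M φ xs
  closeEx-witness zero    φ sat = noEnv , sat
  closeEx-witness (suc m) φ sat with closeEx-witness m (∃' φ) sat
  ... | xs , d , sat′ = ext d xs , sat′

  bigOr-witness : ∀ {k} n (φ : Fin n → Formula S k) (e : Fin k → D) →
    Sat M (bigOr n φ) e → ∃[ i ] Sat M (φ i) e
  bigOr-witness (suc n) φ e (inj₁ sat) = zero , sat
  bigOr-witness (suc n) φ e (inj₂ sat) with bigOr-witness n (φ ∘ suc) e sat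
  ... | i , sat′ = suc i , sat′

stepwise-antitone : {A : Set} {_≈_ _≼_ : A → A → Set} → IsPreorder _≈_ _≼_ →
  (g : ℕ → A) → (∀ j → g (suc j) ≼ g j) → ∀ {t s} → t ≤′ s → g s ≼ g t
stepwise-antitone ≼ g step ≤′-refl           = IsPreorder.refl ≼
stepwise-antitone ≼ g step (≤′-step {s} t≤s) =
  IsPreorder.trans ≼ (step s) (stepwise-antitone ≼ g step t≤s)

persists-until : {P Q : ℕ → Set} →
  (∀ j → Dec (Q j)) → (∀ j → P j → ¬ Q j → P (suc j)) →
  ∀ {t l} → t ≤‴ l → P t → Q l → ∃[ s ] t ≤ s × P s × Q s
persists-until Q? persists {t} t≤l Pₜ Qₗ with Q? t
... | yes Qₜ = t , ≤-refl , Pₜ , Qₜ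
persists-until Q? persists ≤‴-refl        Pₜ Qₗ | no ¬Qₜ = contradiction Qₗ ¬Qₜ
persists-until Q? persists (≤‴-step t<l) Pₜ Qₗ | no ¬Qₜ
  with persists-until Q? persists t<l (persists _ Pₜ ¬Qₜ) Qₗ
... | s , t<s , Pₛ , Qₛ = s , <⇒≤ t<s , Pₛ , Qₛ

module _ {A : Set} {_≼_ : A → A → Set} (wfpo : IsWfpo _≼_) where

  open NonStrictToStrict _≡_ _≼_ using (_<_; <-≤-trans)
  private module ≼ = IsPartialOrder (proj₁ wfpo)

  no-eventual-descent : (g : ℕ → A) → ¬ (∀ t → ∃[ t′ ] g t′ < g t)
  no-eventual-descent g descends = proj₂ wfpo (g ∘ position , λ i → proj₂ (descends (position i)))
    where
    position : ℕ → ℕ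
    position zero    = zero
    position (suc i) = proj₁ (descends (position i))

  fair-descent-impossible : {I : Set} (g : ℕ → A) (Ψ R : I → ℕ → Set) →
    (∀ o j → Dec (R o j)) →
    (∀ j → g (suc j) ≼ g j) →
    (∀ j → ∃[ o ] Ψ o j) →
    (∀ o j → Ψ o j → ¬ R o j → Ψ o (suc j)) →
    (∀ o j → Ψ o j → R o j → g (suc j) < g j) →
    (∀ o t → ∃[ l ] t ≤ l × R o l) → ⊥
  fair-descent-impossible g Ψ R R? g-stepwise-antitone helpful persists decreases fair =
    no-eventual-descent g descends
    where
    descends : ∀ t → ∃[ t′ ] g t′ < g t
    descends t with helpful t
    ... | o , Ψₜ with fair o t
    ... | l , t≤l , Rₗ with persists-until (R? o) (persists o) (≤⇒≤‴ t≤l) Ψₜ Rₗ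
    ... | s , t≤s , Ψₛ , Rₛ =
      suc s , <-≤-trans sym ≼.trans ≼.antisym ≼.≤-respʳ-≈ (decreases o s Ψₛ Rₛ)
                        (stepwise-antitone ≼.isPreorder g g-stepwise-antitone (≤⇒≤′ t≤s))

module _ {S : Signature} {D : Set} (d : D) where

  valid-tilde : (G χ : Formula (Dbl S) 0) → Valid (G ⇒' tilde χ) →
    ∀ M₀ M₁ → Sat (pair M₀ M₁) G noEnv → Sat (pair M₁ M₀) χ noEnv
  valid-tilde G χ G⇒χ̃ M₀ M₁ G-holds =
    to (Sat-swF M₀ M₁ χ noEnv) (G⇒χ̃ D d (pair M₀ M₁) noEnv G-holds)

  valid-bigOr-closeEx : ∀ n m (φ : Formula S 0) (ψ : Fin n → Formula S m) →
    Valid (φ ⇒' bigOr n (λ i → closeEx m (ψ i))) →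
    ∀ M → Sat M φ noEnv → Σ (Fin n × (Fin m → D)) λ (i , xs) → Sat M (ψ i) xs
  valid-bigOr-closeEx n m φ ψ φ⇒ψ M φ-holds
    with bigOr-witness M n (λ i → closeEx m (ψ i)) noEnv (φ⇒ψ D d M noEnv φ-holds)
  ... | i , ∃ψᵢ with closeEx-witness M m (ψ i) ∃ψᵢ
  ... | xs , ψᵢ = (i , xs) , ψᵢ

  module _ {m} (G : Formula (Dbl S) 0) (α β : Formula S m) (M₀ M₁ : Structure S D)
           (G-holds : Sat (pair M₀ M₁) G noEnv) (xs : Fin m → D) (α-holds : Sat M₀ α xs) where

    private
      G-holds′ : Sat (pair M₀ M₁) (weaken G) xs
      G-holds′ = from (Sat-weaken (pair M₀ M₁) G xs) G-holds

      α-holds′ : Sat (pair M₀ M₁) (unp α) xs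
      α-holds′ = from (Sat-unp M₀ M₁ α xs) α-holds

    valid-persist : Valid (weaken G ∧' unp α ∧' ¬' unp β ⇒' prm α) →
      ¬ Sat M₀ β xs → Sat M₁ α xs
    valid-persist step ¬β = to (Sat-prm M₀ M₁ α xs)
      (step D d (pair M₀ M₁) xs (G-holds′ , α-holds′ , ¬β ∘ to (Sat-unp M₀ M₁ β xs)))

    valid-tilde-weaken : (χ : Formula (Dbl S) 0) →
      Valid (weaken G ∧' unp α ∧' unp β ⇒' weaken (tilde χ)) →
      Sat M₀ β xs → Sat (pair M₁ M₀) χ noEnv
    valid-tilde-weaken χ step β-holds =
      to (Sat-swF M₀ M₁ χ noEnv) (to (Sat-weaken (pair M₀ M₁) (tilde χ) xs)
        (step D d (pair M₀ M₁) xs (G-holds′ , α-holds′ , from (Sat-unp M₀ M₁ β xs) β-holds)))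

guard : ∀ {S} → Formula (Dbl S) 0 → Formula S 0 → Formula S 0 → Formula (Dbl S) 0
guard τ φ q = unp φ ∧' τ ∧' ¬' prm q

module _ {S : Signature} {ι : Formula S 0} {τ : Formula (Dbl S) 0} (T : Trace S ι τ) where

  transition : ℕ → Structure (Dbl S) (Dom T)
  transition j = pair (π T j) (π T (suc j))

  invariant : (ρ : Formula S 0) → Valid (ι ⇒' ρ) → Valid (unp ρ ∧' τ ⇒' prm ρ) →
    ∀ j → Sat (π T j) ρ noEnv
  invariant ρ ι⇒ρ ρ-step zero    = ι⇒ρ (Dom T) (inhabited T) (π T 0) noEnv (initial T)
  invariant ρ ι⇒ρ ρ-step (suc j) = to (Sat-prm (π T j) (π T (suc j)) ρ noEnv)
    (ρ-step (Dom T) (inhabited T) (transition j) noEnv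
      (from (Sat-unp (π T j) (π T (suc j)) ρ noEnv) (invariant ρ ι⇒ρ ρ-step j) , step T j))

  guarded-invariant : (φ q : Formula S 0) (k : ℕ) → Valid (guard τ φ q ⇒' prm φ) →
    Sat (π T k) φ noEnv → (∀ j → ¬ Sat (π T (j + k)) q noEnv) →
    ∀ j → Sat (transition (j + k)) (guard τ φ q) noEnv
  guarded-invariant φ q k φ-step φₖ q-never j =
    from (Sat-unp (π T (j + k)) (π T (suc j + k)) φ noEnv) (φ-holds j) , step T (j + k) ,
    q-never (suc j) ∘ to (Sat-prm (π T (j + k)) (π T (suc j + k)) q noEnv)
    where
    φ-holds : ∀ j → Sat (π T (j + k)) φ noEnv
    φ-holds zero    = φₖ
    φ-holds (suc j) = to (Sat-prm (π T (j + k)) (π T (suc j + k)) φ noEnv)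
      (φ-step (Dom T) (inhabited T) (transition (j + k)) noEnv
        (guarded-invariant φ q k φ-step φₖ q-never j))

  fair-suffix : ∀ {n m} {r : Fin n → Formula S m} → Fair T r →
    ∀ k i xs t → ∃[ s ] t ≤ s × Sat (π T (s + k)) (r i) xs
  fair-suffix {r = r} fair k i xs t with fair i xs (t + k)
  ... | l , t+k≤l , rₗ =
    l ∸ k , subst (_≤ l ∸ k) (m+n∸n≡m t k) (∸-monoˡ-≤ k t+k≤l) ,
    subst (λ l′ → Sat (π T l′) (r i) xs) (sym (m∸n+n≡m (m+n≤o⇒n≤o t t+k≤l))) rₗ

mainTheorem12 :
    ExcludedMiddle 0ℓ →
    (S : Signature) (ι : Formula S 0) (τ : Formula (Dbl S) 0)
    (n m : ℕ) (r : Fin n → Formula S m) (p q : Formula S 0)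
    (φ≤ φ< : Formula (Dbl S) 0) → ClosedImplicitRanking S φ≤ φ< →
    (ρ φ : Formula S 0) (ψ : Fin n → Formula S m) →
    Valid (ι ⇒' ρ) →
    Valid (unp ρ ∧' τ ⇒' prm ρ) →
    Valid (ρ ∧' p ∧' ¬' q ⇒' φ) →
    Valid (unp φ ∧' τ ∧' ¬' prm q ⇒' prm φ) →
    Valid (unp φ ∧' τ ∧' ¬' prm q ⇒' tilde φ≤) →
    Valid (φ ⇒' bigOr n (λ i → closeEx m (ψ i))) →
    ((i : Fin n) →
      Valid (weaken (unp φ ∧' τ ∧' ¬' prm q) ∧' unp (ψ i) ∧' ¬' unp (r i)
               ⇒' prm (ψ i))) →
    ((i : Fin n) →
      Valid (weaken (unp φ ∧' τ ∧' ¬' prm q) ∧' unp (ψ i) ∧' unp (r i)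
               ⇒' weaken (tilde φ<))) →
    SatisfiesFairResponse S ι τ n m r p q
mainTheorem12 lem S ι τ n m r p q φ≤ φ< ranking ρ φ ψ
              ι⇒ρ ρ-step ρpq⇒φ φ-step φ-≤ φ⇒ψ ψ-step ψr-< T fair k pₖ
  with lem {∃[ l ] k ≤ l × Sat (π T l) q noEnv} | ranking (Dom T) (inhabited T)
... | yes response   | _ = response
... | no no-response | A , _≼_ , wfpo , rank , rank-sound =
  ⊥-elim (fair-descent-impossible wfpo (rank ∘ state) Ψ R (λ _ _ → lem)
            rank-antitone helpful ψ-persists rank-decreases
            (λ (i , xs) → fair-suffix T {r = r} fair k i xs))
  where
  open NonStrictToStrict _≡_ _≼_ using (_<_)
  d : Dom T
  d = inhabited T
  state : ℕ → Structure S (Dom T)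
  state j = π T (j + k)
  Ψ R : Fin n × (Fin m → Dom T) → ℕ → Set
  Ψ (i , xs) j = Sat (state j) (ψ i) xs
  R (i , xs) j = Sat (state j) (r i) xs
  φₖ : Sat (π T k) φ noEnv
  φₖ = ρpq⇒φ _ d (π T k) noEnv
         (invariant T ρ ι⇒ρ ρ-step k , pₖ , λ qₖ → no-response (k , ≤-refl , qₖ))
  guarded : ∀ j → Sat (transition T (j + k)) (guard τ φ q) noEnv
  guarded = guarded-invariant T φ q k φ-step φₖ λ j qⱼ → no-response (j + k , m≤n+m k j , qⱼ)
  rank-antitone : ∀ j → rank (state (suc j)) ≼ rank (state j)
  rank-antitone j =
    proj₁ (rank-sound _ _) (valid-tilde d (guard τ φ q) φ≤ φ-≤ _ _ (guarded j))
  helpful : ∀ j → ∃[ o ] Ψ o j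
  helpful j =
    valid-bigOr-closeEx d n m φ ψ φ⇒ψ _ (to (Sat-unp _ _ φ noEnv) (proj₁ (guarded j)))
  ψ-persists : ∀ o j → Ψ o j → ¬ R o j → Ψ o (suc j)
  ψ-persists (i , xs) j ψᵢ =
    valid-persist d (guard τ φ q) (ψ i) (r i) _ _ (guarded j) xs ψᵢ (ψ-step i)
  rank-decreases : ∀ o j → Ψ o j → R o j → rank (state (suc j)) < rank (state j)
  rank-decreases (i , xs) j ψᵢ rᵢ =
    proj₂ (rank-sound _ _)
      (valid-tilde-weaken d (guard τ φ q) (ψ i) (r i) _ _ (guarded j) xs ψᵢ φ< (ψr-< i) rᵢ)
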